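{- Let $S=\lambda\sqcup\mu$ be a splice of a set partition $\lambda$ of $[n]$ (with set of vertical edges $\mu$). Then $|\mathrm{CR}(S)|=|\lambda|+|\mu|-2|\mathrm{bind}(S)|$.
   Context: $[[n]]=\{(i,j):1\le i<j\le n\}$. A set partition of $[n]$ is $\lambda\subseteq[[n]]$ with no two distinct elements sharing a first coordinate or sharing a second coordinate. For disjoint set partitions $\lambda,\mu$, $S=\lambda\sqcup\mu$ is a splice of $\lambda$ if (S1) for every $(i,k)\in\mu$ there is $j$, $i<j<k$, with $(i,j)\in\lambda$ or $(j,k)\in\lambda$; (S2) for all $1\le j<k\le n$: there is $i$ with $(i,j)\in\lambda,(i,k)\in\mu$ iff there is $l$ with $(k,l)\in\lambda,(j,l)\in\mu$. $\mathrm{bind}(S)=\{(i,j,k,l):(i,j),(k,l)\in\lambda,(i,k),(j,l)\in\mu,j<k\}$. Columns: equivalence classes of $\lambda$ under the relation generated by $(i,j)\sim(k,l)$ for $(i,j,k,l)\in\mathrm{bind}(S)$; rows: equivalence classes of $\mu$ under the relation generated by $(i,k)\sim(j,l)$ for $(i,j,k,l)\in\mathrm{bind}(S)$. $\mathrm{CR}(S)$ is the disjoint union of the set of columns and the set of rows. -}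

module Defs where

open import Level using (0ℓ)
open import Data.Nat using (ℕ; _≤_; _<_; _<?_; _*_; _+_)
open import Data.Nat.Properties using () renaming (_≟_ to _≟ℕ_)
open import Data.Product using (Σ; ∃; ∃-syntax; _×_; _,_; proj₁; proj₂)
open import Data.Product.Properties using (≡-dec)
open import Data.Sum using (_⊎_)
open import Data.List using (List; length; filter; cartesianProduct; map)
open import Data.List.Relation.Unary.All using (All)
open import Data.List.Relation.Unary.Unique.Propositional using (Unique)
open import Data.List.Relation.Unary.AllPairs using (AllPairs)
open import Data.List.Membership.Propositional using (_∈_; _∉_)
open import Relation.Binary.PropositionalEquality using (_≡_; _≢_)
open import Relation.Binary.Definitions using (DecidableEquality)
open import Relation.Binary.Construct.Closure.Equivalence using (EqClosure)
open import Relation.Nullary using (¬_; Dec)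
open import Relation.Nullary.Decidable using (_×-dec_)
open import Function.Bundles using (_⇔_)
import Data.List.Membership.DecPropositional as DecMem

-- An element (i , j) of [[n]] = {(i,j) : 1 ≤ i < j ≤ n}
Pair : Set
Pair = ℕ × ℕ

InRange : ℕ → Pair → Set
InRange n (i , j) = 1 ≤ i × i < j × j ≤ n

_≟P_ : DecidableEquality Pair
_≟P_ = ≡-dec _≟ℕ_ _≟ℕ_

open DecMem _≟P_ using (_∈?_)

-- Finite subsets of [[n]] are represented as duplicate-free lists; |X| = length X.
-- A set partition of [n]: a subset of [[n]] in which no two distinct elements
-- share a first coordinate or share a second coordinate.
IsSetPartition : ℕ → List Pair → Set
IsSetPartition n lam =
  Unique lam × All (InRange n) lam ×
  (∀ {a b} → a ∈ lam → b ∈ lam → a ≢ b →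
     (proj₁ a ≢ proj₁ b) × (proj₂ a ≢ proj₂ b))

Disjoint : List Pair → List Pair → Set
Disjoint xs ys = ∀ {a} → a ∈ xs → a ∉ ys

IsSplice : ℕ → List Pair → List Pair → Set
IsSplice n lam mu =
  IsSetPartition n lam × IsSetPartition n mu × Disjoint lam mu ×
  (∀ {i k} → (i , k) ∈ mu → ∃[ j ] (i < j × j < k × ((i , j) ∈ lam ⊎ (j , k) ∈ lam))) ×
  (∀ j k → 1 ≤ j → j < k → k ≤ n →
     (∃[ i ] ((i , j) ∈ lam × (i , k) ∈ mu)) ⇔ (∃[ l ] ((k , l) ∈ lam × (j , l) ∈ mu)))

Quad : Set
Quad = ℕ × ℕ × ℕ × ℕ

BindCond : List Pair → Pair × Pair → Set
BindCond mu ((i , j) , (k , l)) = j < k × (i , k) ∈ mu × (j , l) ∈ mu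

bindCond? : (mu : List Pair) → (pq : Pair × Pair) → Dec (BindCond mu pq)
bindCond? mu ((i , j) , (k , l)) = (j <? k) ×-dec (((i , k) ∈? mu) ×-dec ((j , l) ∈? mu))

toQuad : Pair × Pair → Quad
toQuad ((i , j) , (k , l)) = i , j , k , l

bind : List Pair → List Pair → List Quad
bind lam mu = map toQuad (filter (bindCond? mu) (cartesianProduct lam lam))

ColStep : List Pair → List Pair → Pair → Pair → Set
ColStep lam mu (i , j) (k , l) =
  (i , j) ∈ lam × (k , l) ∈ lam × (i , k) ∈ mu × (j , l) ∈ mu × j < k

RowStep : List Pair → List Pair → Pair → Pair → Set
RowStep lam mu (i , k) (j , l) =
  (i , j) ∈ lam × (k , l) ∈ lam × (i , k) ∈ mu × (j , l) ∈ mu × j < k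

-- A complete system of distinct representatives of the equivalence classes of
-- the finite set xs under the equivalence relation generated by R.
-- Its length is the number of equivalence classes.
IsClassTransversal : (Pair → Pair → Set) → List Pair → List Pair → Set
IsClassTransversal R xs reps =
  All (_∈ xs) reps × Unique reps ×
  AllPairs (λ a b → ¬ EqClosure R a b) reps ×
  (∀ {x} → x ∈ xs → ∃[ r ] (r ∈ reps × EqClosure R x r))

IsColumnReps : List Pair → List Pair → List Pair → Set
IsColumnReps lam mu = IsClassTransversal (ColStep lam mu) lam

IsRowReps : List Pair → List Pair → List Pair → Set
IsRowReps lam mu = IsClassTransversal (RowStep lam mu) mu

module Submission where

open import Defs
open import Level using (0ℓ)
open import Data.Nat using (ℕ; suc; _+_; _*_; _≤_; _<_; _∸_; z≤n; s≤s)
open import Data.Nat.Properties using (+-suc; +-comm; ≤-antisym; <-trans; <⇒≤; ≤-trans; ∸-monoʳ-<)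
open import Data.Nat.Induction using (<-wellFounded)
open import Data.Nat.Solver using (module +-*-Solver)
open import Data.List using (List; []; _∷_; length; filter; map; cartesianProduct)
open import Data.List.Properties using (length-removeAt′; length-map)
import Data.List.Relation.Unary.All as All
open import Data.List.Relation.Unary.Any as Any using (Any; here; there; _─_)
open import Data.List.Relation.Unary.AllPairs using (AllPairs; []; _∷_)
open import Data.List.Relation.Unary.Unique.Propositional using (Unique)
import Data.List.Relation.Unary.Unique.Propositional.Properties as Unique
open import Data.List.Membership.Propositional using (_∈_; find; lose)
open import Data.List.Membership.Propositional.Properties using (∈-filter⁺; ∈-filter⁻; ∈-cartesianProduct⁺; ∈-cartesianProduct⁻; ∈-map⁺; ∈-map⁻)
open import Data.Product using (∃; ∃-syntax; _×_; _,_; proj₁; proj₂)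
open import Data.Empty using (⊥-elim)
open import Function using (flip)
open import Induction.WellFounded using (WellFounded; Acc; acc; module Subrelation)
import Relation.Binary.Construct.On as On
open import Relation.Binary.Core using (Rel)
open import Relation.Binary.Definitions using (Symmetric)
open import Relation.Binary.Construct.Closure.Equivalence using (EqClosure; symmetric)
open import Relation.Binary.Construct.Closure.Symmetric using (fwd; bwd)
open import Relation.Binary.Construct.Closure.ReflexiveTransitive as Star using (Star; ε; _◅_; _◅◅_)
open import Relation.Binary.PropositionalEquality using (_≡_; _≢_; refl; sym; trans; cong; cong₂; subst; module ≡-Reasoning)
open import Relation.Nullary using (¬_; Dec; yes; no)
open import Relation.Nullary.Decidable using (map′)
open import Relation.Unary using (Pred; Decidable)
open import Relation.Unary.Properties using (∁?)

-- In a bind quadruple (i,j,k,l) the column step (i,j) ↦ (k,l) and the row step (i,k) ↦ (j,l)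
-- are partial functions (λ and μ are set partitions) that strictly increase the first coordinate.
-- Each of the two relations is therefore a forest: every element flows to a unique sink, and two
-- elements are equivalent exactly when they flow to the same sink. So the classes are counted by
-- the sinks, #classes = #elements − #edges, and in both forests the edges correspond to bind(S).

∈-─⁺ : ∀ {A : Set} {x y : A} {ys : List A} (y∈ys : y ∈ ys) → x ∈ ys → x ≢ y → x ∈ (ys ─ y∈ys)
∈-─⁺ (here refl) (here refl) x≢y = ⊥-elim (x≢y refl)
∈-─⁺ (here _)    (there x∈ys) _  = x∈ys
∈-─⁺ (there _)   (here x≡z)   _  = here x≡z
∈-─⁺ (there y∈ys) (there x∈ys) x≢y = there (∈-─⁺ y∈ys x∈ys x≢y)

injection⇒length≤ : ∀ {A B : Set} (P : A → B → Set) {xs : List A} {ys : List B} → Unique xs →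
  (∀ {x} → x ∈ xs → ∃[ y ] (y ∈ ys × P x y)) →
  (∀ {x x′ y} → x ∈ xs → x′ ∈ xs → P x y → P x′ y → x ≡ x′) →
  length xs ≤ length ys
injection⇒length≤ P {[]}     _            _     _   = z≤n
injection⇒length≤ P {x ∷ xs} {ys} (x∉xs ∷ !xs) image inj with image (here refl)
... | y , y∈ys , Pxy = subst (suc (length xs) ≤_) (sym (length-removeAt′ ys _))
  (s≤s (injection⇒length≤ P !xs image′ (λ m m′ → inj (there m) (there m′))))
  where
  image′ : ∀ {x′} → x′ ∈ xs → ∃[ y′ ] (y′ ∈ (ys ─ y∈ys) × P x′ y′)
  image′ x′∈xs with image (there x′∈xs)
  ... | y′ , y′∈ys , Px′y′ = y′ , ∈-─⁺ y∈ys y′∈ys y′≢y , Px′y′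
    where
    y′≢y : y′ ≢ y
    y′≢y refl = All.lookup x∉xs x′∈xs (inj (here refl) (there x′∈xs) Pxy Px′y′)

length-filter+length-filter∁ : ∀ {A : Set} {P : Pred A 0ℓ} (P? : Decidable P) (xs : List A) →
  length (filter P? xs) + length (filter (∁? P?) xs) ≡ length xs
length-filter+length-filter∁ P? []       = refl
length-filter+length-filter∁ P? (x ∷ xs) with P? x
... | yes _ = cong suc (length-filter+length-filter∁ P? xs)
... | no  _ = trans (+-suc _ _) (cong suc (length-filter+length-filter∁ P? xs))

AllPairs-∁⇒≡ : ∀ {A : Set} {S : Rel A 0ℓ} {xs : List A} {x y : A} → Symmetric S →
  AllPairs (λ a b → ¬ S a b) xs → x ∈ xs → y ∈ xs → S x y → x ≡ y
AllPairs-∁⇒≡ sym-S (_ ∷ _)    (here refl) (here refl) _   = refl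
AllPairs-∁⇒≡ sym-S (¬S ∷ _)   (here refl) (there y∈)  Sxy = ⊥-elim (All.lookup ¬S y∈ Sxy)
AllPairs-∁⇒≡ sym-S (¬S ∷ _)   (there x∈)  (here refl) Sxy = ⊥-elim (All.lookup ¬S x∈ (sym-S Sxy))
AllPairs-∁⇒≡ sym-S (_ ∷ ¬Ss)  (there x∈)  (there y∈)  Sxy = AllPairs-∁⇒≡ sym-S ¬Ss x∈ y∈ Sxy

AllPairs-map∈ : ∀ {A : Set} {R S : Rel A 0ℓ} {xs : List A} →
  (∀ {x y} → x ∈ xs → y ∈ xs → R x y → S x y) → AllPairs R xs → AllPairs S xs
AllPairs-map∈ f []         = []
AllPairs-map∈ f (Rx ∷ Rxs) =
  All.tabulate (λ y∈ → f (here refl) (there y∈) (All.lookup Rx y∈)) ∷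
  AllPairs-map∈ (λ x∈ y∈ → f (there x∈) (there y∈)) Rxs

module FunctionalForest
  (R : Pair → Pair → Set)
  (R-functional : ∀ {a b c} → R a b → R a c → b ≡ c)
  (R-wellFounded : WellFounded (flip R))
  where

  Sink : Pair → Set
  Sink a = ¬ ∃ (R a)

  Star-from-sink : ∀ {s t} → Sink s → Star R s t → s ≡ t
  Star-from-sink _    ε       = refl
  Star-from-sink sink (r ◅ _) = ⊥-elim (sink (_ , r))

  Star-to-sink-resp-EqClosure : ∀ {a b s} → Sink s → EqClosure R a b → Star R a s → Star R b s
  Star-to-sink-resp-EqClosure sink ε              a⇝s = a⇝s
  Star-to-sink-resp-EqClosure sink (bwd r ◅ a~b)  a⇝s = Star-to-sink-resp-EqClosure sink a~b (r ◅ a⇝s)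
  Star-to-sink-resp-EqClosure sink (fwd r ◅ a~b)  ε   = ⊥-elim (sink (_ , r))
  Star-to-sink-resp-EqClosure sink (fwd r ◅ a~b)  (r′ ◅ a′⇝s) with R-functional r r′
  ... | refl = Star-to-sink-resp-EqClosure sink a~b a′⇝s

  EqClosure-sinks⇒≡ : ∀ {s t} → Sink s → Sink t → EqClosure R s t → s ≡ t
  EqClosure-sinks⇒≡ sink-s sink-t s~t =
    sym (Star-from-sink sink-t (Star-to-sink-resp-EqClosure sink-s s~t ε))

  module Counting
    (V : List Pair) (V-unique : Unique V)
    (E : List (Pair × Pair)) (E-unique : Unique E)
    (E-sound : ∀ {a b} → (a , b) ∈ E → R a b)
    (E-complete : ∀ {a b} → R a b → (a , b) ∈ E)
    (R-source : ∀ {a b} → R a b → a ∈ V)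
    (R-target : ∀ {a b} → R a b → b ∈ V)
    where

    hasSuccessor? : ∀ a → Dec (∃ (R a))
    hasSuccessor? a = map′ fromE toE (Any.any? (λ e → proj₁ e ≟P a) E)
      where
      fromE : Any (λ e → proj₁ e ≡ a) E → ∃ (R a)
      fromE a∈E with find a∈E
      ... | (_ , b) , e∈E , refl = b , E-sound e∈E
      toE : ∃ (R a) → Any (λ e → proj₁ e ≡ a) E
      toE (_ , r) = lose (E-complete r) refl

    sinks : List Pair
    sinks = filter (∁? hasSuccessor?) V

    nonSinks : List Pair
    nonSinks = filter hasSuccessor? V

    reachesSink : ∀ {a} → Acc (flip R) a → a ∈ V → ∃[ s ] (s ∈ sinks × Star R a s)
    reachesSink {a} (acc rec) a∈V with hasSuccessor? a
    ... | no sink = a , ∈-filter⁺ (∁? hasSuccessor?) a∈V sink , ε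
    ... | yes (b , r) with reachesSink (rec r) (R-target r)
    ...   | s , s∈sinks , b⇝s = s , s∈sinks , r ◅ b⇝s

    ∈-sinks⁻ : ∀ {s} → s ∈ sinks → s ∈ V × Sink s
    ∈-sinks⁻ = ∈-filter⁻ (∁? hasSuccessor?) {xs = V}

    sinks-unique : Unique sinks
    sinks-unique = Unique.filter⁺ (∁? hasSuccessor?) V-unique

    EqClosure-on-sinks⇒≡ : ∀ {s t} → s ∈ sinks → t ∈ sinks → EqClosure R s t → s ≡ t
    EqClosure-on-sinks⇒≡ s∈ t∈ = EqClosure-sinks⇒≡ (proj₂ (∈-sinks⁻ s∈)) (proj₂ (∈-sinks⁻ t∈))

    sinks-isTransversal : IsClassTransversal R V sinks
    sinks-isTransversal =
      All.tabulate (λ s∈ → proj₁ (∈-sinks⁻ s∈)) ,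
      sinks-unique ,
      AllPairs-map∈ (λ s∈ t∈ s≢t s~t → s≢t (EqClosure-on-sinks⇒≡ s∈ t∈ s~t)) sinks-unique ,
      λ a∈V → let s , s∈ , a⇝s = reachesSink (R-wellFounded _) a∈V in s , s∈ , Star.map fwd a⇝s

    transversal-length : ∀ {reps} → IsClassTransversal R V reps → length reps ≡ length sinks
    transversal-length (reps⊆V , reps-unique , reps-apart , covered) = ≤-antisym
      (injection⇒length≤ (Star R) reps-unique
        (λ r∈ → reachesSink (R-wellFounded _) (All.lookup reps⊆V r∈))
        (λ r∈ r′∈ r⇝s r′⇝s → AllPairs-∁⇒≡ (symmetric R) reps-apart r∈ r′∈
          (Star.map fwd r⇝s ◅◅ symmetric R (Star.map fwd r′⇝s))))
      (injection⇒length≤ (EqClosure R) sinks-unique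
        (λ s∈ → covered (proj₁ (∈-sinks⁻ s∈)))
        (λ s∈ t∈ s~r t~r → EqClosure-on-sinks⇒≡ s∈ t∈ (s~r ◅◅ symmetric R t~r)))

    nonSinks-length : length nonSinks ≡ length E
    nonSinks-length = ≤-antisym
      (injection⇒length≤ (λ a e → proj₁ e ≡ a) (Unique.filter⁺ hasSuccessor? V-unique)
        (λ a∈ → let b , r = proj₂ (∈-filter⁻ hasSuccessor? {xs = V} a∈) in (_ , b) , E-complete r , refl)
        (λ _ _ e≡a e≡a′ → trans (sym e≡a) e≡a′))
      (injection⇒length≤ (λ e a → proj₁ e ≡ a) E-unique
        (λ {e} e∈ → proj₁ e , ∈-filter⁺ hasSuccessor? (R-source (E-sound e∈)) (_ , E-sound e∈) , refl)
        sameSource⇒≡)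
      where
      sameSource⇒≡ : ∀ {e e′ a} → e ∈ E → e′ ∈ E → proj₁ e ≡ a → proj₁ e′ ≡ a → e ≡ e′
      sameSource⇒≡ e∈ e′∈ refl refl = cong₂ _,_ refl (R-functional (E-sound e∈) (E-sound e′∈))

    transversal+edges≡vertices : ∀ {reps} → IsClassTransversal R V reps →
      length reps + length E ≡ length V
    transversal+edges≡vertices {reps} reps-transversal = begin
      length reps + length E      ≡⟨ cong₂ _+_ (transversal-length reps-transversal) (sym nonSinks-length) ⟩
      length sinks + length nonSinks ≡⟨ +-comm (length sinks) (length nonSinks) ⟩
      length nonSinks + length sinks ≡⟨ length-filter+length-filter∁ hasSuccessor? V ⟩
      length V                    ∎
      where open ≡-Reasoning

setPartition-proj₁-injective : ∀ {n P a b} → IsSetPartition n P → a ∈ P → b ∈ P →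
  proj₁ a ≡ proj₁ b → a ≡ b
setPartition-proj₁-injective {a = a} {b} (_ , _ , distinct) a∈ b∈ a₁≡b₁ with a ≟P b
... | yes a≡b = a≡b
... | no  a≢b = ⊥-elim (proj₁ (distinct a∈ b∈ a≢b) a₁≡b₁)

boundedIncreasing⇒wellFounded : ∀ {A : Set} {R : A → A → Set} (rank : A → ℕ) n →
  (∀ {a b} → R a b → rank a < rank b × rank b ≤ n) → WellFounded (flip R)
boundedIncreasing⇒wellFounded {R = R} rank n step =
  Subrelation.wellFounded decreasing (On.wellFounded (λ a → n ∸ rank a) <-wellFounded)
  where
  decreasing : ∀ {b a} → R a b → n ∸ rank b < n ∸ rank a
  decreasing r = let a<b , b≤n = step r in ∸-monoʳ-< a<b b≤n

transpose : Pair × Pair → Pair × Pair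
transpose ((i , j) , (k , l)) = (i , k) , (j , l)

-- transpose is definitionally an involution.
transpose-injective : ∀ {q q′} → transpose q ≡ transpose q′ → q ≡ q′
transpose-injective = cong transpose

bindPairs : List Pair → List Pair → List (Pair × Pair)
bindPairs lam mu = filter (bindCond? mu) (cartesianProduct lam lam)

module SpliceForests {n : ℕ} {lam mu : List Pair}
  (lam-partition : IsSetPartition n lam) (mu-partition : IsSetPartition n mu) where

  bindPairs-unique : Unique (bindPairs lam mu)
  bindPairs-unique = Unique.filter⁺ (bindCond? mu)
    (Unique.cartesianProduct⁺ (proj₁ lam-partition) (proj₁ lam-partition))

  ∈-bindPairs⁻ : ∀ {a b} → (a , b) ∈ bindPairs lam mu → ColStep lam mu a b
  ∈-bindPairs⁻ m with ∈-filter⁻ (bindCond? mu) {xs = cartesianProduct lam lam} m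
  ... | ab∈ , j<k , ik∈mu , jl∈mu =
    let a∈ , b∈ = ∈-cartesianProduct⁻ lam lam ab∈ in a∈ , b∈ , ik∈mu , jl∈mu , j<k

  ∈-bindPairs⁺ : ∀ {a b} → ColStep lam mu a b → (a , b) ∈ bindPairs lam mu
  ∈-bindPairs⁺ (a∈ , b∈ , ik∈mu , jl∈mu , j<k) =
    ∈-filter⁺ (bindCond? mu) (∈-cartesianProduct⁺ a∈ b∈) (j<k , ik∈mu , jl∈mu)

  inRange : ∀ {P a} → IsSetPartition n P → a ∈ P → InRange n a
  inRange (_ , inRange-P , _) = All.lookup inRange-P

  colStep-functional : ∀ {a b c} → ColStep lam mu a b → ColStep lam mu a c → b ≡ c
  colStep-functional (_ , b∈ , ik∈ , _) (_ , c∈ , ik′∈ , _)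
    with setPartition-proj₁-injective mu-partition ik∈ ik′∈ refl
  ... | refl = setPartition-proj₁-injective lam-partition b∈ c∈ refl

  rowStep-functional : ∀ {a b c} → RowStep lam mu a b → RowStep lam mu a c → b ≡ c
  rowStep-functional (ij∈ , kl∈ , _) (ij′∈ , kl′∈ , _)
    with setPartition-proj₁-injective lam-partition ij∈ ij′∈ refl
       | setPartition-proj₁-injective lam-partition kl∈ kl′∈ refl
  ... | refl | refl = refl

  colStep-increasing : ∀ {a b} → ColStep lam mu a b → proj₁ a < proj₁ b × proj₁ b ≤ n
  colStep-increasing (a∈ , b∈ , _ , _ , j<k) =
    let _ , i<j , _ = inRange lam-partition a∈
        _ , k<l , l≤n = inRange lam-partition b∈
    in <-trans i<j j<k , ≤-trans (<⇒≤ k<l) l≤n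

  rowStep-increasing : ∀ {a b} → RowStep lam mu a b → proj₁ a < proj₁ b × proj₁ b ≤ n
  rowStep-increasing (ij∈ , _ , _ , jl∈ , _) =
    let _ , i<j , _ = inRange lam-partition ij∈
        _ , j<l , l≤n = inRange mu-partition jl∈
    in i<j , ≤-trans (<⇒≤ j<l) l≤n

  module Columns = FunctionalForest.Counting (ColStep lam mu) colStep-functional
    (boundedIncreasing⇒wellFounded proj₁ n colStep-increasing)
    lam (proj₁ lam-partition) (bindPairs lam mu) bindPairs-unique ∈-bindPairs⁻ ∈-bindPairs⁺
    proj₁ (λ (_ , b∈ , _) → b∈)

  rowEdges : List (Pair × Pair)
  rowEdges = map transpose (bindPairs lam mu)

  ∈-rowEdges⁻ : ∀ {a b} → (a , b) ∈ rowEdges → RowStep lam mu a b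
  ∈-rowEdges⁻ m with ∈-map⁻ transpose m
  ... | _ , q∈ , refl = ∈-bindPairs⁻ q∈

  ∈-rowEdges⁺ : ∀ {a b} → RowStep lam mu a b → (a , b) ∈ rowEdges
  ∈-rowEdges⁺ r = ∈-map⁺ transpose (∈-bindPairs⁺ r)

  module Rows = FunctionalForest.Counting (RowStep lam mu) rowStep-functional
    (boundedIncreasing⇒wellFounded proj₁ n rowStep-increasing)
    mu (proj₁ mu-partition) rowEdges (Unique.map⁺ transpose-injective bindPairs-unique)
    ∈-rowEdges⁻ ∈-rowEdges⁺ (λ (_ , _ , ik∈ , _) → ik∈) (λ (_ , _ , _ , jl∈ , _) → jl∈)

  columns+bind≡lam : ∀ {cols} → IsColumnReps lam mu cols →
    length cols + length (bind lam mu) ≡ length lam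
  columns+bind≡lam {cols} cols-transversal =
    trans (cong (length cols +_) (length-map toQuad (bindPairs lam mu)))
          (Columns.transversal+edges≡vertices cols-transversal)

  rows+bind≡mu : ∀ {rows} → IsRowReps lam mu rows →
    length rows + length (bind lam mu) ≡ length mu
  rows+bind≡mu {rows} rows-transversal =
    trans (cong (length rows +_) |bind|≡|rowEdges|) (Rows.transversal+edges≡vertices rows-transversal)
    where
    |bind|≡|rowEdges| : length (bind lam mu) ≡ length rowEdges
    |bind|≡|rowEdges| =
      trans (length-map toQuad (bindPairs lam mu)) (sym (length-map transpose (bindPairs lam mu)))

open +-*-Solver using (solve; _:+_; _:*_; _:=_; con)

sum-of-complements : ∀ c r b l m → c + b ≡ l → r + b ≡ m → c + r + 2 * b ≡ l + m
sum-of-complements c r b _ _ refl refl =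
  solve 3 (λ c r b → c :+ r :+ con 2 :* b := (c :+ b) :+ (r :+ b)) refl c r b

proposition3p5 : (n : ℕ) (lam mu : List Pair) → IsSplice n lam mu →
    (∃[ cols ] ∃[ rows ] (IsColumnReps lam mu cols × IsRowReps lam mu rows)) ×
    (∀ cols rows → IsColumnReps lam mu cols → IsRowReps lam mu rows →
      length cols + length rows + 2 * length (bind lam mu) ≡ length lam + length mu)
proposition3p5 n lam mu (lam-partition , mu-partition , _) =
  (Columns.sinks , Rows.sinks , Columns.sinks-isTransversal , Rows.sinks-isTransversal) ,
  λ cols rows cols-transversal rows-transversal →
    sum-of-complements (length cols) (length rows) (length (bind lam mu)) (length lam) (length mu)
      (columns+bind≡lam cols-transversal) (rows+bind≡mu rows-transversal)
  where open SpliceForests lam-partition mu-partition
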